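{- Let $\mathcal M$ be a playable coalition model, $w$ a state, $\varphi\in\mathcal L_{CL}$ and $C\subseteq D\subseteq N$. Then (1) if $\mathcal M,w\models\mathrm{FI}_D(\varphi)$ then $\mathcal M,w\models\mathrm{FI}_C(\varphi)$; and (2) if $\mathcal M,w\models\mathrm{FC}_C(\varphi)$ then $\mathcal M,w\models\mathrm{FC}_D(\varphi)$.
   Context: Let $N=\{1,\dots,n\}$ be a finite set of agents, $\mathsf{Prop}$ a countable set of atoms. The language $\mathcal L_{CL}$: $\varphi::=p\mid\neg\varphi\mid(\varphi\wedge\psi)\mid[C]\varphi$ ($C\subseteq N$). A coalition model is $\mathcal M=(W,E,V)$ with $W\ne\emptyset$, $E_w(C)\subseteq\mathcal P(W)$ for each $w\in W$, $C\subseteq N$, $V:\mathsf{Prop}\to\mathcal P(W)$; atoms via $V$, Booleans classical, $\mathcal M,w\models[C]\varphi$ iff $\{u\mid\mathcal M,u\models\varphi\}\in E_w(C)$. For $X\subseteq W$, $\overline X=W\setminus X$. $E_w$ is playable if: (i) $\emptyset\notin E_w(C)$ for all $C$; (ii) $W\in E_w(C)$ for all $C$; (iii) if $X\in E_w(C)$ and $X\subseteq Y\subseteq W$ then $Y\in E_w(C)$; (iv) if $C\cap D=\emptyset$, $X\in E_w(C)$, $Y\in E_w(D)$ then $X\cap Y\in E_w(C\cup D)$; (v) for every $X$, $X\notin E_w(\emptyset)$ iff $\overline X\in E_w(N)$. The model is playable if every $E_w$ is. $\mathrm{FC}_C(\varphi):=[C]\varphi\wedge[C]\neg\varphi$; $\mathrm{FI}_C(\varphi):=\neg[C]\varphi\wedge\neg[C]\neg\varphi$.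 -}

module Defs where

open import Data.Nat using (ℕ)
open import Data.Fin using (Fin)
open import Data.Product using (_×_)
open import Data.Empty using (⊥)
open import Data.Unit using (⊤)
open import Relation.Nullary using (¬_)
open import Function.Bundles using (_⇔_)
import Data.Fin.Subset as S
open S using (Subset)

Coalition : ℕ → Set
Coalition n = Subset n

data Formula (n : ℕ) : Set where
  atom : ℕ → Formula n
  ¬ᶠ_  : Formula n → Formula n
  _∧ᶠ_ : Formula n → Formula n → Formula n
  [_]_ : Coalition n → Formula n → Formula n

PSet : Set → Set₁
PSet W = W → Set

_⊆ᵂ_ : {W : Set} → PSet W → PSet W → Set
X ⊆ᵂ Y = ∀ u → X u → Y u

_∩ᵂ_ : {W : Set} → PSet W → PSet W → PSet W
(X ∩ᵂ Y) u = X u × Y u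

compl : {W : Set} → PSet W → PSet W
compl X u = ¬ X u

emptyᵂ : {W : Set} → PSet W
emptyᵂ _ = ⊥

fullᵂ : {W : Set} → PSet W
fullᵂ _ = ⊤

Disjoint : {n : ℕ} → Coalition n → Coalition n → Set
Disjoint C D = ∀ i → i S.∈ C → ¬ (i S.∈ D)

-- Coalition model (W, E, V), with W nonempty.
record CoalitionModel (n : ℕ) : Set₁ where
  field
    W   : Set
    w₀  : W
    E   : W → Coalition n → PSet W → Set
    V   : ℕ → PSet W

record PlayableAt {n : ℕ} (M : CoalitionModel n) (w : CoalitionModel.W M) : Set₁ where
  open CoalitionModel M
  field
    p-i   : ∀ C → ¬ E w C emptyᵂ
    p-ii  : ∀ C → E w C fullᵂ
    p-iii : ∀ C (X Y : PSet W) → E w C X → X ⊆ᵂ Y → E w C Y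
    p-iv  : ∀ C D (X Y : PSet W) → Disjoint C D → E w C X → E w D Y
              → E w (C S.∪ D) (X ∩ᵂ Y)
    p-v   : ∀ (X : PSet W) → (¬ E w S.⊥ X) ⇔ E w S.⊤ (compl X)

Playable : {n : ℕ} → CoalitionModel n → Set₁
Playable M = ∀ w → PlayableAt M w

_,_⊨_ : {n : ℕ} (M : CoalitionModel n) → CoalitionModel.W M → Formula n → Set
M , w ⊨ atom p = CoalitionModel.V M p w
M , w ⊨ (¬ᶠ φ) = ¬ (M , w ⊨ φ)
M , w ⊨ (φ ∧ᶠ ψ) = (M , w ⊨ φ) × (M , w ⊨ ψ)
M , w ⊨ ([ C ] φ) = CoalitionModel.E M w C (λ u → M , u ⊨ φ)

FC : {n : ℕ} → Coalition n → Formula n → Formula n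
FC C φ = ([ C ] φ) ∧ᶠ ([ C ] (¬ᶠ φ))

FI : {n : ℕ} → Coalition n → Formula n → Formula n
FI C φ = (¬ᶠ ([ C ] φ)) ∧ᶠ (¬ᶠ ([ C ] (¬ᶠ φ)))

-- Superadditivity (iv) lets C join forces with the disjoint coalition D ─ C, which can
-- always force W by (ii); with outcome monotonicity (iii) this makes effectivity monotone
-- in the coalition. Forcing thus passes up from C to D, and its failure passes down.
module Submission where

open import Defs
open import Data.Nat using (ℕ)
open import Data.Product using (_×_; _,_; proj₁; map)
open import Data.Sum using (inj₁; inj₂; [_,_])
open import Data.Fin.Subset using (Subset; _∈_; _⊆_; _∉_; _∪_; _─_; inside; outside)
open import Data.Fin.Subset.Properties
  using (_∈?_; ⊆-antisym; x∈p∪q⁻; x∈p∪q⁺; x∈p∧x∉q⇒x∈p─q; p─q⊆p)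
open import Data.Vec.Base using (_∷_; here; there)
open import Relation.Binary.PropositionalEquality using (_≡_; subst)
open import Relation.Nullary using (yes; no)
open import Function using (_∘_)

x∈p─q⇒x∉q : ∀ {n} (p q : Subset n) {x} → x ∈ p ─ q → x ∉ q
x∈p─q⇒x∉q (_ ∷ p) (outside ∷ q) (there x∈p─q) (there x∈q) = x∈p─q⇒x∉q p q x∈p─q x∈q
x∈p─q⇒x∉q (_ ∷ p) (inside  ∷ q) (there x∈p─q) (there x∈q) = x∈p─q⇒x∉q p q x∈p─q x∈q

disjoint-─ : ∀ {n} (C D : Subset n) → Disjoint C (D ─ C)
disjoint-─ C D i i∈C i∈D─C = x∈p─q⇒x∉q D C i∈D─C i∈C

p⊆q⇒p∪[q─p]≡q : ∀ {n} {p q : Subset n} → p ⊆ q → p ∪ (q ─ p) ≡ q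
p⊆q⇒p∪[q─p]≡q {p = p} {q} p⊆q = ⊆-antisym
  ([ p⊆q , p─q⊆p q p ] ∘ x∈p∪q⁻ p (q ─ p))
  x∈q⇒x∈p∪[q─p]
  where
  x∈q⇒x∈p∪[q─p] : q ⊆ p ∪ (q ─ p)
  x∈q⇒x∈p∪[q─p] {x} x∈q with x ∈? p
  ... | yes x∈p = x∈p∪q⁺ (inj₁ x∈p)
  ... | no  x∉p = x∈p∪q⁺ (inj₂ (x∈p∧x∉q⇒x∈p─q x∈q x∉p))

module _ {n : ℕ} (M : CoalitionModel n) where
  open CoalitionModel M

  effectivity-mono : ∀ {w} → PlayableAt M w → ∀ {C D : Coalition n} {X : PSet W} →
                     C ⊆ D → E w C X → E w D X
  effectivity-mono {w} play {C} {D} {X} C⊆D C-forces-X =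
    subst (λ Z → E w Z X) (p⊆q⇒p∪[q─p]≡q C⊆D)
      (p-iii _ _ X (p-iv C (D ─ C) X fullᵂ (disjoint-─ C D) C-forces-X (p-ii _))
        (λ _ → proj₁))
    where open PlayableAt play

proposition6p8 : {n : ℕ} (M : CoalitionModel n) → Playable M
    → (w : CoalitionModel.W M) (φ : Formula n) (C D : Coalition n) → C ⊆ D
    → ((M , w ⊨ FI D φ) → (M , w ⊨ FI C φ))
    × ((M , w ⊨ FC C φ) → (M , w ⊨ FC D φ))
proposition6p8 M playable w φ C D C⊆D =
  map (_∘ lift) (_∘ lift) , map lift lift
  where
  lift : ∀ {X} → CoalitionModel.E M w C X → CoalitionModel.E M w D X
  lift = effectivity-mono M (playable w) C⊆D
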